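{- There are infinitely many connected bidegreed graphs whose two degrees are $\Delta$ and $\Delta-1$ for some $\Delta$. Moreover, every $n$-vertex connected bidegreed graph $G$ with degrees $\Delta$ and $\Delta-1$ satisfies $$\Omega(G)=\frac{\mathrm{Var}(G)}{S(G)}=\frac1{2n}.$$
   Context: A bidegreed graph has exactly two distinct vertex degrees. For a graph with $n$ vertices, $m$ edges and degrees $d_1,\dots,d_n$: $S(G)=\sum_i|d_i-\frac{2m}{n}|$, $\mathrm{Var}(G)=\frac1n\sum_i(d_i-\frac{2m}{n})^2$, $\Omega(G)=\mathrm{Var}(G)/S(G)$. -}

module Defs where

open import Data.Nat as ℕ using (ℕ; zero; suc; _<_; _≤_)
open import Data.Bool using (Bool; true; false; if_then_else_)
open import Data.Fin using (Fin; toℕ)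
open import Data.List using (List; map; allFin; filter)
open import Data.Nat.ListAction using (sum)
open import Data.Integer as ℤ using (+_)
open import Data.Rational as ℚ using (ℚ; 0ℚ; _/_; _÷_; ∣_∣; ≢-nonZero)
open import Data.Rational.Properties using (_≟_)
open import Data.Product using (Σ; ∃; _×_; _,_)
open import Data.Sum using (_⊎_)
open import Relation.Binary.PropositionalEquality using (_≡_; _≢_)
open import Relation.Nullary using (yes; no)

record Graph (n : ℕ) : Set where
  field
    adj     : Fin n → Fin n → Bool
    adj-sym : ∀ i j → adj i j ≡ adj j i
    irrefl  : ∀ i → adj i i ≡ false
open Graph public

indicator : Bool → ℕ
indicator true  = 1
indicator false = 0

deg : ∀ {n} → Graph n → Fin n → ℕ
deg {n} G i = sum (map (λ j → indicator (adj G i j)) (allFin n))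

edges : ∀ {n} → Graph n → ℕ
edges {n} G =
  sum (map (λ i → sum (map (λ j → if toℕ i ℕ.<ᵇ toℕ j then indicator (adj G i j) else 0)
                           (allFin n)))
           (allFin n))

data Reach {n} (G : Graph n) : Fin n → Fin n → Set where
  here : ∀ {i} → Reach G i i
  step : ∀ {i j k} → adj G i j ≡ true → Reach G j k → Reach G i k

Connected : ∀ {n} → Graph n → Set
Connected {n} G = ∀ (i j : Fin n) → Reach G i j

BidegreedΔΔ-1 : ∀ {n} → Graph n → ℕ → Set
BidegreedΔΔ-1 {n} G Δ =
  (1 ≤ Δ) ×
  (∀ i → deg G i ≡ Δ ⊎ deg G i ≡ Δ ℕ.∸ 1) ×
  (∃ λ i → deg G i ≡ Δ) × (∃ λ i → deg G i ≡ Δ ℕ.∸ 1)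

avgDeg : ∀ {n} → Graph n → ℚ
avgDeg {zero}  G = 0ℚ
avgDeg {suc k} G = (+ (2 ℕ.* edges G)) / suc k

toℚ : ℕ → ℚ
toℚ k = + k / 1

sumℚ : List ℚ → ℚ
sumℚ = Data.List.foldr ℚ._+_ 0ℚ

S : ∀ {n} → Graph n → ℚ
S {n} G = sumℚ (map (λ i → ∣ toℚ (deg G i) ℚ.- avgDeg G ∣) (allFin n))

Var : ∀ {n} → Graph n → ℚ
Var {zero}  G = 0ℚ
Var {suc k} G =
  (+ 1 / suc k) ℚ.* sumℚ (map (λ i → (toℚ (deg G i) ℚ.- avgDeg G) ℚ.* (toℚ (deg G i) ℚ.- avgDeg G))
                              (allFin (suc k)))

-- Ω(G) = Var(G)/S(G)   (set to 0 when S(G) = 0, which never happens for bidegreed graphs)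
Ω : ∀ {n} → Graph n → ℚ
Ω G with S G ≟ 0ℚ
... | yes _  = 0ℚ
... | no s≢0 = (Var G ÷ S G) {{≢-nonZero s≢0}}

inv2n : ℕ → ℚ
inv2n zero    = 0ℚ
inv2n (suc k) = + 1 / (2 ℕ.* suc k)

-- Let x i = d i − 2m/n be the deviations of the degrees from their mean. By the
-- handshake lemma they sum to 0, and they take the two values a = Δ − 2m/n and
-- a − 1, so 0 ≤ a ≤ 1. On these two values |x| = 2x² + (1 − 2a)x, hence summing
-- over the vertices kills the linear term: S(G) = 2 Σ x i² = 2n Var(G). Since both
-- values occur, S(G) ≥ max(a, 1 − a) > 0. For infinitely many examples take the
-- complete graph on n ≥ 3 vertices minus one edge, with degrees n − 1 and n − 2.
module Submission where

open import Defs
open import Data.Nat using (ℕ; _≤_)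
open import Data.Product using (Σ; ∃; _×_)
open import Relation.Binary.PropositionalEquality using (_≡_)

open import Data.Nat as ℕ using (zero; suc; _+_; _*_; _∸_; _<_; _<ᵇ_; _≡ᵇ_; z≤n; s≤s)
import Data.Nat.Properties as ℕP
open import Data.Nat.Coprimality as Coprime using ()
open import Data.Bool using (true; false; not; _∧_; if_then_else_; T)
open import Data.Bool.Properties using (∧-zeroʳ)
open import Data.Fin as Fin using (Fin; toℕ)
open import Data.Fin.Properties using (toℕ-injective)
open import Data.Fin.Patterns using (0F; 1F; 2F)
open import Data.Integer as ℤ using (+_)
import Data.Integer.Properties as ℤP
open import Data.Integer.Solver using () renaming (module +-*-Solver to ℤ-Solver)
open import Data.Rational as ℚ using (ℚ; mkℚ; 0ℚ; 1ℚ; ∣_∣; _/_; 1/_; toℚᵘ; ≢-nonZero)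
import Data.Rational.Properties as ℚP
open import Data.Rational.Solver using () renaming (module +-*-Solver to ℚ-Solver)
open import Data.Rational.Unnormalised as ℚᵘ using (mkℚᵘ; *≡*)
import Data.Rational.Unnormalised.Properties as ℚᵘP
import Data.List as List
import Data.List.Properties as List
open import Data.Nat.ListAction using () renaming (sum to sumℕ)
open import Data.Vec.Functional as Vector using (Vector; removeAt)
open import Data.Product as Product using (_,_; proj₁; proj₂)
open import Data.Sum as Sum using (_⊎_; inj₁; inj₂)
open import Data.Empty using (⊥-elim)
open import Function using (id; _∘_)
open import Relation.Nullary using (yes; no)
open import Relation.Binary.PropositionalEquality
  using (_≢_; refl; sym; trans; cong; cong₂; subst; module ≡-Reasoning)
open import Algebra.Bundles using (module Ring)
import Algebra.Properties.CommutativeMonoid.Sum as CommutativeMonoidSum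
import Algebra.Properties.Semiring.Sum as SemiringSum

module ℕΣ = CommutativeMonoidSum ℕP.+-0-commutativeMonoid
open SemiringSum (Ring.semiring ℚP.+-*-ring)
  using (sum; sum-syntax; sum-cong-≗; ∑-distrib-+; *-distribˡ-sum; sum-remove; sum-replicate-zero)

foldr-map-allFin : ∀ {a b} {A : Set a} {B : Set b} (_∙_ : A → B → B) (e : B) {n} (f : Fin n → A) →
                   List.foldr _∙_ e (List.map f (List.allFin n)) ≡ Vector.foldr _∙_ e f
foldr-map-allFin {A = A} _∙_ e {n} f =
  trans (cong (List.foldr _∙_ e) (List.map-tabulate id f)) (foldr-tabulate n f)
  where
  foldr-tabulate : ∀ n (f : Fin n → A) → List.foldr _∙_ e (List.tabulate f) ≡ Vector.foldr _∙_ e f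
  foldr-tabulate zero    f = refl
  foldr-tabulate (suc n) f = cong (f Fin.zero ∙_) (foldr-tabulate n (f ∘ Fin.suc))

toℚ≡mkℚ : ∀ k → toℚ k ≡ mkℚ (+ k) 0 (Coprime.sym (Coprime.1-coprimeTo k))
toℚ≡mkℚ k = ℚP.normalize-coprime (Coprime.sym (Coprime.1-coprimeTo k))

toℚ-+ : ∀ a b → toℚ (a + b) ≡ toℚ a ℚ.+ toℚ b
toℚ-+ a b rewrite toℚ≡mkℚ a | toℚ≡mkℚ b =
  cong (_/ 1) (trans (ℤP.pos-+ a b) (sym (cong₂ ℤ._+_ (ℤP.*-identityʳ (+ a)) (ℤP.*-identityʳ (+ b)))))

toℚ-∸1 : ∀ {d} → 1 ≤ d → toℚ (d ∸ 1) ≡ toℚ d ℚ.- 1ℚ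
toℚ-∸1 {d} 1≤d = begin
  toℚ (d ∸ 1)                    ≡⟨ solve 1 (λ e → e := (e :+ con 1ℚ) :- con 1ℚ) refl (toℚ (d ∸ 1)) ⟩
  (toℚ (d ∸ 1) ℚ.+ 1ℚ) ℚ.- 1ℚ    ≡⟨ cong (ℚ._- 1ℚ) (toℚ-+ (d ∸ 1) 1) ⟨
  toℚ (d ∸ 1 + 1) ℚ.- 1ℚ         ≡⟨ cong (λ e → toℚ e ℚ.- 1ℚ) (ℕP.m∸n+n≡m 1≤d) ⟩
  toℚ d ℚ.- 1ℚ                   ∎
  where
  open ≡-Reasoning
  open ℚ-Solver

toℚ-∑ : ∀ {n} (f : Vector ℕ n) → toℚ (ℕΣ.sum f) ≡ ∑[ i < n ] toℚ (f i)
toℚ-∑ {zero}  f = refl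
toℚ-∑ {suc n} f = trans (toℚ-+ (f Fin.zero) _) (cong (toℚ (f Fin.zero) ℚ.+_) (toℚ-∑ (f ∘ Fin.suc)))

toℚᵘ-/ : ∀ z n → toℚᵘ (z / suc n) ℚᵘ.≃ mkℚᵘ z n
toℚᵘ-/ z n = ℚP.toℚᵘ-fromℚᵘ (mkℚᵘ z n)

[z/n]*n≡z : ∀ z n → (z / suc n) ℚ.* toℚ (suc n) ≡ z / 1
[z/n]*n≡z z n = ℚP.toℚᵘ-injective (begin
  toℚᵘ ((z / suc n) ℚ.* toℚ (suc n))         ≈⟨ ℚP.toℚᵘ-homo-* (z / suc n) (toℚ (suc n)) ⟩
  toℚᵘ (z / suc n) ℚᵘ.* toℚᵘ (toℚ (suc n))   ≈⟨ ℚᵘP.*-cong (toℚᵘ-/ z n) (toℚᵘ-/ (+ suc n) 0) ⟩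
  mkℚᵘ z n ℚᵘ.* mkℚᵘ (+ suc n) 0             ≈⟨ *≡* (solve 2 (λ z m → (z :* m) :* con (+ 1) := z :* (m :* con (+ 1))) refl z (+ suc n)) ⟩
  mkℚᵘ z 0                                   ≈⟨ toℚᵘ-/ z 0 ⟨
  toℚᵘ (z / 1)                               ∎)
  where
  open ℚᵘP.≃-Reasoning
  open ℤ-Solver

z/2n+z/2n≡z/n : ∀ z n → z / (2 * suc n) ℚ.+ z / (2 * suc n) ≡ z / suc n
z/2n+z/2n≡z/n z n = ℚP.toℚᵘ-injective (begin
  toℚᵘ (h ℚ.+ h)              ≈⟨ ℚP.toℚᵘ-homo-+ h h ⟩
  toℚᵘ h ℚᵘ.+ toℚᵘ h          ≈⟨ ℚᵘP.+-cong (toℚᵘ-/ z _) (toℚᵘ-/ z _) ⟩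
  mkℚᵘ z _ ℚᵘ.+ mkℚᵘ z _      ≈⟨ *≡* eq ⟩
  mkℚᵘ z n                    ≈⟨ toℚᵘ-/ z n ⟨
  toℚᵘ (z / suc n)            ∎)
  where
  open ℚᵘP.≃-Reasoning
  open ℤ-Solver
  m : ℕ
  m = suc n
  h : ℚ
  h = z / (2 * m)
  eq : (z ℤ.* + (2 * m) ℤ.+ z ℤ.* + (2 * m)) ℤ.* + m ≡ z ℤ.* + ((2 * m) * (2 * m))
  eq rewrite ℤP.pos-* (2 * m) (2 * m) | ℤP.pos-* 2 m =
    solve 2 (λ z m → (z :* (con (+ 2) :* m) :+ z :* (con (+ 2) :* m)) :* m
                   := z :* ((con (+ 2) :* m) :* (con (+ 2) :* m))) refl z (+ m)

∑-const : ∀ n c → ∑[ _ < n ] c ≡ toℚ n ℚ.* c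
∑-const zero    c = sym (ℚP.*-zeroˡ c)
∑-const (suc n) c = begin
  c ℚ.+ ∑[ _ < n ] c     ≡⟨ cong (c ℚ.+_) (∑-const n c) ⟩
  c ℚ.+ toℚ n ℚ.* c      ≡⟨ solve 2 (λ c N → c :+ N :* c := (con 1ℚ :+ N) :* c) refl c (toℚ n) ⟩
  (1ℚ ℚ.+ toℚ n) ℚ.* c   ≡⟨ cong (ℚ._* c) (toℚ-+ 1 n) ⟨
  toℚ (suc n) ℚ.* c      ∎
  where
  open ≡-Reasoning
  open ℚ-Solver

∑-mono-≤ : ∀ {n} {f g : Vector ℚ n} → (∀ i → f i ℚ.≤ g i) → sum f ℚ.≤ sum g
∑-mono-≤ {zero}  f≤g = ℚP.≤-refl
∑-mono-≤ {suc n} f≤g = ℚP.+-mono-≤ (f≤g Fin.zero) (∑-mono-≤ (f≤g ∘ Fin.suc))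

∑-nonneg : ∀ {n} {f : Vector ℚ n} → (∀ i → 0ℚ ℚ.≤ f i) → 0ℚ ℚ.≤ sum f
∑-nonneg {n} {f} 0≤f = subst (ℚ._≤ sum f) (sum-replicate-zero n) (∑-mono-≤ 0≤f)

term≤∑ : ∀ {n} (f : Vector ℚ (suc n)) → (∀ i → 0ℚ ℚ.≤ f i) → ∀ i → f i ℚ.≤ sum f
term≤∑ f 0≤f i = begin
  f i                          ≡⟨ ℚP.+-identityʳ (f i) ⟨
  f i ℚ.+ 0ℚ                   ≤⟨ ℚP.+-monoʳ-≤ (f i) (∑-nonneg (0≤f ∘ Fin.punchIn i)) ⟩
  f i ℚ.+ sum (removeAt f i)   ≡⟨ sum-remove f ⟨
  sum f                        ∎
  where open ℚP.≤-Reasoning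

∑≡0⇒bounds-straddle-0 : ∀ {n} (x : Vector ℚ (suc n)) {l u} → sum x ≡ 0ℚ →
                        (∀ i → l ℚ.≤ x i × x i ℚ.≤ u) → l ℚ.≤ 0ℚ × 0ℚ ℚ.≤ u
∑≡0⇒bounds-straddle-0 {n} x {l} {u} ∑x≡0 l≤x≤u =
  cancel (begin
    N ℚ.* l           ≡⟨ ∑-const (suc n) l ⟨
    ∑[ _ < suc n ] l  ≤⟨ ∑-mono-≤ (proj₁ ∘ l≤x≤u) ⟩
    sum x             ≡⟨ trans ∑x≡0 (sym (ℚP.*-zeroʳ N)) ⟩
    N ℚ.* 0ℚ          ∎)
  , cancel (begin
    N ℚ.* 0ℚ          ≡⟨ trans (ℚP.*-zeroʳ N) (sym ∑x≡0) ⟩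
    sum x             ≤⟨ ∑-mono-≤ (proj₂ ∘ l≤x≤u) ⟩
    ∑[ _ < suc n ] u  ≡⟨ ∑-const (suc n) u ⟩
    N ℚ.* u           ∎)
  where
  open ℚP.≤-Reasoning
  N : ℚ
  N = toℚ (suc n)
  cancel : ∀ {p q} → N ℚ.* p ℚ.≤ N ℚ.* q → p ℚ.≤ q
  cancel = ℚP.*-cancelˡ-≤-pos N {{ℚP.normalize-pos (suc n) 1}}

-- Centred vectors with two values one apart

a-1≤a : ∀ a → a ℚ.- 1ℚ ℚ.≤ a
a-1≤a a = subst (a ℚ.- 1ℚ ℚ.≤_) (ℚP.+-identityʳ a) (ℚP.+-monoʳ-≤ a (ℚ.*≤* ℤ.-≤+))

∣a-1∣≡1-a : ∀ a → a ℚ.- 1ℚ ℚ.≤ 0ℚ → ∣ a ℚ.- 1ℚ ∣ ≡ 1ℚ ℚ.- a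
∣a-1∣≡1-a a a-1≤0 = begin
  ∣ a ℚ.- 1ℚ ∣          ≡⟨ ℚP.∣-p∣≡∣p∣ (a ℚ.- 1ℚ) ⟨
  ∣ ℚ.- (a ℚ.- 1ℚ) ∣    ≡⟨ ℚP.0≤p⇒∣p∣≡p (ℚP.neg-antimono-≤ a-1≤0) ⟩
  ℚ.- (a ℚ.- 1ℚ)        ≡⟨ solve 1 (λ a → :- (a :- con 1ℚ) := con 1ℚ :- a) refl a ⟩
  1ℚ ℚ.- a              ∎
  where
  open ≡-Reasoning
  open ℚ-Solver

∣x∣≡2x²+[1-2a]x : ∀ {a x} → 0ℚ ℚ.≤ a → a ℚ.- 1ℚ ℚ.≤ 0ℚ → x ≡ a ⊎ x ≡ a ℚ.- 1ℚ →
                   ∣ x ∣ ≡ (x ℚ.* x ℚ.+ x ℚ.* x) ℚ.+ (1ℚ ℚ.- (a ℚ.+ a)) ℚ.* x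
∣x∣≡2x²+[1-2a]x {a} 0≤a _ (inj₁ refl) = trans (ℚP.0≤p⇒∣p∣≡p 0≤a)
  (solve 1 (λ a → a := (a :* a :+ a :* a) :+ (con 1ℚ :- (a :+ a)) :* a) refl a)
  where open ℚ-Solver
∣x∣≡2x²+[1-2a]x {a} _ a-1≤0 (inj₂ refl) = trans (∣a-1∣≡1-a a a-1≤0)
  (solve 1 (λ a → con 1ℚ :- a := ((a :- con 1ℚ) :* (a :- con 1ℚ) :+ (a :- con 1ℚ) :* (a :- con 1ℚ))
                                  :+ (con 1ℚ :- (a :+ a)) :* (a :- con 1ℚ)) refl a)
  where open ℚ-Solver

module CentredUnitGap {n} (x : Vector ℚ (suc n)) {a : ℚ}
                      (x∈ : ∀ i → x i ≡ a ⊎ x i ≡ a ℚ.- 1ℚ) (∑x≡0 : sum x ≡ 0ℚ) where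

  private
    bounds : a ℚ.- 1ℚ ℚ.≤ 0ℚ × 0ℚ ℚ.≤ a
    bounds = ∑≡0⇒bounds-straddle-0 x ∑x≡0 (between ∘ x∈)
      where
      between : ∀ {y} → y ≡ a ⊎ y ≡ a ℚ.- 1ℚ → a ℚ.- 1ℚ ℚ.≤ y × y ℚ.≤ a
      between (inj₁ refl) = a-1≤a a , ℚP.≤-refl
      between (inj₂ refl) = ℚP.≤-refl , a-1≤a a

    a-1≤0 : a ℚ.- 1ℚ ℚ.≤ 0ℚ
    a-1≤0 = proj₁ bounds

    0≤a : 0ℚ ℚ.≤ a
    0≤a = proj₂ bounds

  ∑∣x∣≡2∑x² : ∑[ i < suc n ] ∣ x i ∣ ≡ ∑[ i < suc n ] (x i ℚ.* x i) ℚ.+ ∑[ i < suc n ] (x i ℚ.* x i)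
  ∑∣x∣≡2∑x² = begin
    ∑[ i < suc n ] ∣ x i ∣                                 ≡⟨ sum-cong-≗ (λ i → ∣x∣≡2x²+[1-2a]x 0≤a a-1≤0 (x∈ i)) ⟩
    ∑[ i < suc n ] ((x² i ℚ.+ x² i) ℚ.+ b ℚ.* x i)          ≡⟨ ∑-distrib-+ (λ i → x² i ℚ.+ x² i) (λ i → b ℚ.* x i) ⟩
    ∑[ i < suc n ] (x² i ℚ.+ x² i) ℚ.+ ∑[ i < suc n ] (b ℚ.* x i)
                                                            ≡⟨ cong₂ ℚ._+_ (∑-distrib-+ x² x²) (sym (*-distribˡ-sum b x)) ⟩
    (sum x² ℚ.+ sum x²) ℚ.+ b ℚ.* sum x                     ≡⟨ cong (λ s → (sum x² ℚ.+ sum x²) ℚ.+ b ℚ.* s) ∑x≡0 ⟩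
    (sum x² ℚ.+ sum x²) ℚ.+ b ℚ.* 0ℚ                        ≡⟨ solve 2 (λ q b → (q :+ q) :+ b :* con 0ℚ := q :+ q) refl (sum x²) b ⟩
    sum x² ℚ.+ sum x²                                       ∎
    where
    open ≡-Reasoning
    open ℚ-Solver
    x² : Vector ℚ (suc n)
    x² i = x i ℚ.* x i
    b : ℚ
    b = 1ℚ ℚ.- (a ℚ.+ a)

  ∑∣x∣≢0 : (∃ λ i → x i ≡ a) → (∃ λ j → x j ≡ a ℚ.- 1ℚ) → ∑[ i < suc n ] ∣ x i ∣ ≢ 0ℚ
  ∑∣x∣≢0 (i , xi≡a) (j , xj≡a-1) ∑∣x∣≡0 = ℚP.<-irrefl refl (ℚP.<-≤-trans (ℚP.positive⁻¹ 1ℚ) (begin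
    1ℚ                      ≡⟨ solve 1 (λ a → con 1ℚ := a :+ (con 1ℚ :- a)) refl a ⟩
    a ℚ.+ (1ℚ ℚ.- a)        ≡⟨ cong₂ ℚ._+_ (ℚP.0≤p⇒∣p∣≡p 0≤a) (∣a-1∣≡1-a a a-1≤0) ⟨
    ∣ a ∣ ℚ.+ ∣ a ℚ.- 1ℚ ∣  ≤⟨ ℚP.+-mono-≤ (≤0 xi≡a) (≤0 xj≡a-1) ⟩
    0ℚ ℚ.+ 0ℚ               ≡⟨⟩
    0ℚ                      ∎))
    where
    open ℚP.≤-Reasoning
    open ℚ-Solver
    ≤0 : ∀ {k y} → x k ≡ y → ∣ y ∣ ℚ.≤ 0ℚ
    ≤0 {k} refl = subst (∣ x k ∣ ℚ.≤_) ∑∣x∣≡0 (term≤∑ (∣_∣ ∘ x) (ℚP.0≤∣p∣ ∘ x) k)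

-- Degrees, the handshake lemma and the deviation from the mean degree

deg≡∑ : ∀ {n} (G : Graph n) i → deg G i ≡ ℕΣ.sum (λ j → indicator (adj G i j))
deg≡∑ G i = foldr-map-allFin _+_ 0 (λ j → indicator (adj G i j))

module _ {n} (G : Graph n) where

  upperAdj : Fin n → Fin n → ℕ
  upperAdj i j = if toℕ i <ᵇ toℕ j then indicator (adj G i j) else 0

  edges≡∑upperAdj : edges G ≡ ℕΣ.sum (λ i → ℕΣ.sum (upperAdj i))
  edges≡∑upperAdj =
    trans (foldr-map-allFin _+_ 0 (λ i → sumℕ (List.map (upperAdj i) (List.allFin n))))
          (ℕΣ.sum-cong-≗ (λ i → foldr-map-allFin _+_ 0 (upperAdj i)))

  indicator-adj≡upperAdj+upperAdj : ∀ i j → indicator (adj G i j) ≡ upperAdj i j + upperAdj j i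
  indicator-adj≡upperAdj+upperAdj i j with toℕ i <ᵇ toℕ j in i<j | toℕ j <ᵇ toℕ i in j<i
  ... | true  | true  = ⊥-elim (ℕP.<-asym (<ᵇ≡true⇒< (toℕ i) (toℕ j) i<j) (<ᵇ≡true⇒< (toℕ j) (toℕ i) j<i))
    where
    <ᵇ≡true⇒< : ∀ m n → (m <ᵇ n) ≡ true → m < n
    <ᵇ≡true⇒< m n eq = ℕP.<ᵇ⇒< m n (subst T (sym eq) _)
  ... | true  | false = sym (ℕP.+-identityʳ _)
  ... | false | true  = cong indicator (adj-sym G i j)
  ... | false | false = subst (λ k → indicator (adj G i k) ≡ 0) i≡j (cong indicator (irrefl G i))
    where
    <ᵇ≡false⇒≥ : ∀ m n → (m <ᵇ n) ≡ false → n ℕ.≤ m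
    <ᵇ≡false⇒≥ m n eq = ℕP.≮⇒≥ (λ m<n → subst T eq (ℕP.<⇒<ᵇ m<n))
    i≡j : i ≡ j
    i≡j = toℕ-injective (ℕP.≤-antisym (<ᵇ≡false⇒≥ (toℕ j) (toℕ i) j<i) (<ᵇ≡false⇒≥ (toℕ i) (toℕ j) i<j))

  handshake : ℕΣ.sum (deg G) ≡ 2 * edges G
  handshake = begin
    ℕΣ.sum (deg G)                                          ≡⟨ ℕΣ.sum-cong-≗ (deg≡∑ G) ⟩
    ℕΣ.sum (λ i → ℕΣ.sum (λ j → indicator (adj G i j)))     ≡⟨ ℕΣ.sum-cong-≗ (ℕΣ.sum-cong-≗ ∘ indicator-adj≡upperAdj+upperAdj) ⟩
    ℕΣ.sum (λ i → ℕΣ.sum (λ j → upperAdj i j + upperAdj j i))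
                                                            ≡⟨ ℕΣ.sum-cong-≗ (λ i → ℕΣ.∑-distrib-+ (upperAdj i) (λ j → upperAdj j i)) ⟩
    ℕΣ.sum (λ i → ℕΣ.sum (upperAdj i) + ℕΣ.sum (λ j → upperAdj j i))
                                                            ≡⟨ ℕΣ.∑-distrib-+ (λ i → ℕΣ.sum (upperAdj i)) (λ i → ℕΣ.sum (λ j → upperAdj j i)) ⟩
    E + ℕΣ.sum (λ i → ℕΣ.sum (λ j → upperAdj j i))          ≡⟨ cong (E ℕ.+_) (ℕΣ.∑-comm (λ i j → upperAdj j i)) ⟩
    E + E                                                   ≡⟨ cong (E ℕ.+_) (ℕP.+-identityʳ E) ⟨
    2 * E                                                   ≡⟨ cong (2 *_) edges≡∑upperAdj ⟨
    2 * edges G                                             ∎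
    where
    open ≡-Reasoning
    E : ℕ
    E = ℕΣ.sum (λ i → ℕΣ.sum (upperAdj i))

deviation : ∀ {n} → Graph n → Fin n → ℚ
deviation G i = toℚ (deg G i) ℚ.- avgDeg G

∑deviation≡0 : ∀ {k} (G : Graph (suc k)) → ∑[ i < suc k ] deviation G i ≡ 0ℚ
∑deviation≡0 {k} G = begin
  ∑[ i < suc k ] (toℚ (deg G i) ℚ.+ (ℚ.- μ))                ≡⟨ ∑-distrib-+ (toℚ ∘ deg G) (λ _ → ℚ.- μ) ⟩
  ∑[ i < suc k ] toℚ (deg G i) ℚ.+ ∑[ _ < suc k ] (ℚ.- μ)    ≡⟨ cong₂ ℚ._+_ (sym (toℚ-∑ (deg G))) (∑-const (suc k) (ℚ.- μ)) ⟩
  toℚ (ℕΣ.sum (deg G)) ℚ.+ N ℚ.* (ℚ.- μ)                    ≡⟨ cong (λ d → toℚ d ℚ.+ N ℚ.* (ℚ.- μ)) (handshake G) ⟩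
  toℚ (2 * edges G) ℚ.+ N ℚ.* (ℚ.- μ)                       ≡⟨ cong (ℚ._+ N ℚ.* (ℚ.- μ)) ([z/n]*n≡z (+ (2 * edges G)) k) ⟨
  μ ℚ.* N ℚ.+ N ℚ.* (ℚ.- μ)                                 ≡⟨ solve 2 (λ μ N → μ :* N :+ N :* (:- μ) := con 0ℚ) refl μ N ⟩
  0ℚ                                                      ∎
  where
  open ≡-Reasoning
  open ℚ-Solver
  μ N : ℚ
  μ = avgDeg G
  N = toℚ (suc k)

S≡∑∣deviation∣ : ∀ {n} (G : Graph n) → S G ≡ ∑[ i < n ] ∣ deviation G i ∣
S≡∑∣deviation∣ G = foldr-map-allFin ℚ._+_ 0ℚ (λ i → ∣ deviation G i ∣)

Var≡t*S⇒Ω≡t : ∀ {n} (G : Graph n) {t} → S G ≢ 0ℚ → Var G ≡ t ℚ.* S G → Ω G ≡ t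
Var≡t*S⇒Ω≡t G {t} S≢0 Var≡t*S with S G ℚP.≟ 0ℚ
... | yes S≡0 = ⊥-elim (S≢0 S≡0)
... | no  S≢0′ = begin
  Var G ℚ.* 1/ S G               ≡⟨ cong (ℚ._* 1/ S G) Var≡t*S ⟩
  (t ℚ.* S G) ℚ.* 1/ S G         ≡⟨ ℚP.*-assoc t (S G) (1/ S G) ⟩
  t ℚ.* (S G ℚ.* 1/ S G)         ≡⟨ cong (t ℚ.*_) (ℚP.*-inverseʳ (S G)) ⟩
  t ℚ.* 1ℚ                       ≡⟨ ℚP.*-identityʳ t ⟩
  t                              ∎
  where
  open ≡-Reasoning
  instance
    _ : ℚ.NonZero (S G)
    _ = ≢-nonZero S≢0′

module Bidegreed {k} (G : Graph (suc k)) {Δ} (1≤Δ : 1 ≤ Δ) (degs : ∀ i → deg G i ≡ Δ ⊎ deg G i ≡ Δ ∸ 1)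
                 (hasΔ : ∃ λ i → deg G i ≡ Δ) (hasΔ-1 : ∃ λ i → deg G i ≡ Δ ∸ 1) where

  private
    a : ℚ
    a = toℚ Δ ℚ.- avgDeg G

    deviation-of-Δ : ∀ {i} → deg G i ≡ Δ → deviation G i ≡ a
    deviation-of-Δ d≡Δ = cong (λ d → toℚ d ℚ.- avgDeg G) d≡Δ

    deviation-of-Δ-1 : ∀ {i} → deg G i ≡ Δ ∸ 1 → deviation G i ≡ a ℚ.- 1ℚ
    deviation-of-Δ-1 {i} d≡Δ-1 = begin
      toℚ (deg G i) ℚ.- avgDeg G             ≡⟨ cong (λ d → toℚ d ℚ.- avgDeg G) d≡Δ-1 ⟩
      toℚ (Δ ∸ 1) ℚ.- avgDeg G               ≡⟨ cong (ℚ._- avgDeg G) (toℚ-∸1 1≤Δ) ⟩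
      (toℚ Δ ℚ.- 1ℚ) ℚ.- avgDeg G            ≡⟨ solve 2 (λ d μ → (d :- con 1ℚ) :- μ := (d :- μ) :- con 1ℚ) refl (toℚ Δ) (avgDeg G) ⟩
      a ℚ.- 1ℚ                               ∎
      where
      open ≡-Reasoning
      open ℚ-Solver

    open CentredUnitGap (deviation G) (Sum.map deviation-of-Δ deviation-of-Δ-1 ∘ degs) (∑deviation≡0 G)

  S≢0 : S G ≢ 0ℚ
  S≢0 = ∑∣x∣≢0 (Product.map₂ deviation-of-Δ hasΔ) (Product.map₂ deviation-of-Δ-1 hasΔ-1) ∘ trans (sym (S≡∑∣deviation∣ G))

  Var≡inv2n*S : Var G ≡ inv2n (suc k) ℚ.* S G
  Var≡inv2n*S = begin
    Var G                     ≡⟨ cong ((+ 1 / suc k) ℚ.*_) (foldr-map-allFin ℚ._+_ 0ℚ x²) ⟩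
    (+ 1 / suc k) ℚ.* sum x²  ≡⟨ cong (ℚ._* sum x²) (z/2n+z/2n≡z/n (+ 1) k) ⟨
    (t ℚ.+ t) ℚ.* sum x²      ≡⟨ solve 2 (λ t q → (t :+ t) :* q := t :* (q :+ q)) refl t (sum x²) ⟩
    t ℚ.* (sum x² ℚ.+ sum x²) ≡⟨ cong (t ℚ.*_) (trans (S≡∑∣deviation∣ G) ∑∣x∣≡2∑x²) ⟨
    t ℚ.* S G                 ∎
    where
    open ≡-Reasoning
    open ℚ-Solver
    t : ℚ
    t = inv2n (suc k)
    x² : Vector ℚ (suc k)
    x² i = deviation G i ℚ.* deviation G i

-- The complete graph minus one edge

≡ᵇ-sym : ∀ m n → (m ≡ᵇ n) ≡ (n ≡ᵇ m)
≡ᵇ-sym zero    zero    = refl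
≡ᵇ-sym zero    (suc n) = refl
≡ᵇ-sym (suc m) zero    = refl
≡ᵇ-sym (suc m) (suc n) = ≡ᵇ-sym m n

≡ᵇ-refl : ∀ m → (m ≡ᵇ m) ≡ true
≡ᵇ-refl zero    = refl
≡ᵇ-refl (suc m) = ≡ᵇ-refl m

-- The missing edge is {0, 1}: it is the only pair with toℕ i + toℕ j ≡ 1.
completeMinusEdge : ∀ n → Graph n
completeMinusEdge n = record
  { adj     = λ i j → not (toℕ i + toℕ j ≡ᵇ 1) ∧ not (toℕ i ≡ᵇ toℕ j)
  ; adj-sym = λ i j → cong₂ (λ s e → not (s ≡ᵇ 1) ∧ not e) (ℕP.+-comm (toℕ i) (toℕ j)) (≡ᵇ-sym (toℕ i) (toℕ j))
  ; irrefl  = λ i → trans (cong (λ e → not (toℕ i + toℕ i ≡ᵇ 1) ∧ not e) (≡ᵇ-refl (toℕ i))) (∧-zeroʳ _)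
  }

Reach-trans : ∀ {n} {G : Graph n} {i j k} → Reach G i j → Reach G j k → Reach G i k
Reach-trans here         r = r
Reach-trans (step e r′) r = step e (Reach-trans r′ r)

∑1≡n : ∀ m → ℕΣ.sum {m} (λ _ → 1) ≡ m
∑1≡n zero    = refl
∑1≡n (suc m) = cong suc (∑1≡n m)

∑-indicator-≢ : ∀ m (i : Fin (suc m)) → ℕΣ.sum {suc m} (λ j → indicator (not (toℕ i ≡ᵇ toℕ j))) ≡ m
∑-indicator-≢ m       Fin.zero    = ∑1≡n m
∑-indicator-≢ (suc m) (Fin.suc i) = cong suc (∑-indicator-≢ m i)

module CompleteMinusEdge (N : ℕ) where

  K : Graph (3 + N)
  K = completeMinusEdge (3 + N)

  toHub : ∀ i → Reach K i 2F
  toHub 0F                          = step refl here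
  toHub 1F                          = step refl here
  toHub 2F                          = here
  toHub (Fin.suc (Fin.suc (Fin.suc i))) = step refl here

  fromHub : ∀ j → Reach K 2F j
  fromHub 0F                          = step refl here
  fromHub 1F                          = step refl here
  fromHub 2F                          = here
  fromHub (Fin.suc (Fin.suc (Fin.suc j))) = step refl here

  connected : Connected K
  connected i j = Reach-trans (toHub i) (fromHub j)

  deg-0 : deg K 0F ≡ 1 + N
  deg-0 = trans (deg≡∑ K 0F) (∑1≡n (1 + N))

  deg-1 : deg K 1F ≡ 1 + N
  deg-1 = trans (deg≡∑ K 1F) (∑1≡n (1 + N))

  deg-suc-suc : ∀ i → deg K (Fin.suc (Fin.suc i)) ≡ 2 + N
  deg-suc-suc i = trans (deg≡∑ K (Fin.suc (Fin.suc i))) (∑-indicator-≢ (2 + N) (Fin.suc (Fin.suc i)))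

  bidegreed : BidegreedΔΔ-1 K (2 + N)
  bidegreed = s≤s z≤n , degs , (2F , deg-suc-suc 0F) , (0F , deg-0)
    where
    degs : ∀ i → deg K i ≡ 2 + N ⊎ deg K i ≡ 1 + N
    degs 0F                    = inj₂ deg-0
    degs 1F                    = inj₂ deg-1
    degs (Fin.suc (Fin.suc i)) = inj₁ (deg-suc-suc i)

proposition35 : ((N : ℕ) → Σ ℕ λ n → N ≤ n × Σ (Graph n) λ G → Connected G × ∃ λ Δ → BidegreedΔΔ-1 G Δ)
    × ((n : ℕ) (G : Graph n) (Δ : ℕ) → Connected G → BidegreedΔΔ-1 G Δ → Ω G ≡ inv2n n)
proposition35 = infinitelyMany , Ω≡inv2n
  where
  infinitelyMany : (N : ℕ) → Σ ℕ λ n → N ≤ n × Σ (Graph n) λ G → Connected G × ∃ λ Δ → BidegreedΔΔ-1 G Δ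
  infinitelyMany N = 3 + N , ℕP.m≤n+m N 3 , K , connected , 2 + N , bidegreed
    where open CompleteMinusEdge N

  Ω≡inv2n : (n : ℕ) (G : Graph n) (Δ : ℕ) → Connected G → BidegreedΔΔ-1 G Δ → Ω G ≡ inv2n n
  Ω≡inv2n zero    G Δ _ (_ , _ , (() , _) , _)
  Ω≡inv2n (suc k) G Δ _ (1≤Δ , degs , hasΔ , hasΔ-1) = Var≡t*S⇒Ω≡t G S≢0 Var≡inv2n*S
    where open Bidegreed G 1≤Δ degs hasΔ hasΔ-1
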